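{- Let $\alpha$ be a positive integer. For every $n\ge1$ and every integer $0\le d<\alpha$, \[ (\alpha n-d)!_{(\alpha)}=[z^n]\,\mathrm{Conv}_n(-\alpha,\alpha n-d;z)=[z^n]\,\mathrm{Conv}_n(\alpha,\alpha-d;z), \] and for every $n\ge1$, \[ n!_{(\alpha)}=\left[z^{\lfloor (n+\alpha-1)/\alpha\rfloor}\right]\mathrm{Conv}_n(-\alpha,n;z) =[z^n]\left(\sum_{0\le d<\alpha}z^{ -d}\,\mathrm{Conv}_n(\alpha,\alpha-d;z^{\alpha})\right) =[z^{n+\alpha-1}]\left(\frac{1-z^{\alpha}}{1-z}\,\mathrm{Conv}_n(-\alpha,n;z^{\alpha})\right). \]
   Context: The $\alpha$-factorial: $n!_{(\alpha)}=n\cdot(n-\alpha)!_{(\alpha)}$ if $n>0$, $=1$ if $-\alpha<n\le0$, $=0$ otherwise. For any nonzero $a$ (positive or negative), parameter $R$ and $h\ge0$, define $P_h(a,R;z)=(1-(R+2a(h-1))z)P_{h-1}(a,R;z)-a(R+a(h-2))(h-1)z^2P_{h-2}(a,R;z)$ for $h\ge2$, $P_1=1$, $P_h=0$ for $h\le0$; $Q_h(a,R;z)$ satisfies the same recurrence for $h\ge2$ with $Q_1=1-Rz$, $Q_0=1$, $Q_h=0$ for $h<0$; and $\mathrm{Conv}_h(a,R;z)=P_h(a,R;z)/Q_h(a,R;z)$, expanded as a formal power series in $z$ (with $z$ replaced by $z^\alpha$ where indicated; terms $z^{ -d}$ give formal Laurent series). $[z^m]F$ denotes the coefficient of $z^m$.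 -}

module Defs where

open import Data.Nat as ℕ using (ℕ; zero; suc; NonZero)
open import Data.Nat.Divisibility using (_∣?_)
open import Data.Nat.DivMod using (_/_)
open import Data.Integer as ℤ using (ℤ; +_; -[1+_]; _+_; _-_; _*_; -_; 0ℤ; 1ℤ)
open import Data.List using (List; []; _∷_; map)
open import Data.Bool using (if_then_else_)
open import Relation.Nullary.Decidable using (does)

-- Implemented with fuel: while n > 0 each step lowers n by α ≥ 1, so
-- fuel  |n| + 1  always suffices to reach the base cases (for α ≥ 1).

afactFuel : ℕ → ℕ → ℤ → ℤ
afactFuel α zero      n = 1ℤ
afactFuel α (suc f) n =
  if does (0ℤ ℤ.<? n)
  then n * afactFuel α f (n - + α)
  else (if does (- (+ α) ℤ.<? n) then 1ℤ else 0ℤ)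

afact : ℕ → ℤ → ℤ
afact α n = afactFuel α (suc ℤ.∣ n ∣) n

-- Polynomials in z with integer coefficients, as coefficient lists
-- (constant term first).

Poly : Set
Poly = List ℤ

addP : Poly → Poly → Poly
addP []       q        = q
addP (x ∷ p)  []       = x ∷ p
addP (x ∷ p)  (y ∷ q)  = (x + y) ∷ addP p q

scaleP : ℤ → Poly → Poly
scaleP c = map (c *_)

zP : Poly → Poly
zP p = 0ℤ ∷ p

coeffP : Poly → ℕ → ℤ
coeffP []       m       = 0ℤ
coeffP (x ∷ p)  zero    = x
coeffP (x ∷ p)  (suc m) = coeffP p m

-- One step of the three-term recurrence, for index h = suc (suc k):
--   F_h = (1 - (R + 2a(h-1)) z) F_{h-1} - a (R + a(h-2)) (h-1) z^2 F_{h-2}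
recStep : ℤ → ℤ → ℕ → Poly → Poly → Poly
recStep a R k F1 F2 =
  addP F1
    (addP (scaleP (- (R + + 2 * a * + (suc k))) (zP F1))
          (scaleP (- (a * (R + a * + k) * + (suc k))) (zP (zP F2))))

recSeq : ℤ → ℤ → Poly → Poly → ℕ → Poly
recSeq a R F0 F1 zero                = F0
recSeq a R F0 F1 (suc zero)          = F1
recSeq a R F0 F1 (suc (suc k))       =
  recStep a R k (recSeq a R F0 F1 (suc k)) (recSeq a R F0 F1 k)

Ppoly : ℤ → ℤ → ℕ → Poly
Ppoly a R = recSeq a R [] (1ℤ ∷ [])

Qpoly : ℤ → ℤ → ℕ → Poly
Qpoly a R = recSeq a R (1ℤ ∷ []) (1ℤ ∷ - R ∷ [])

Series : Set
Series = ℕ → ℤ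

sumTo : ℕ → (ℕ → ℤ) → ℤ
sumTo zero    f = 0ℤ
sumTo (suc n) f = sumTo n f + f n

mulS : Series → Series → Series
mulS f g m = sumTo (suc m) (λ i → f i * g (m ℕ.∸ i))

dotTail : Series → List ℤ → ℤ
dotTail q []       = 0ℤ
dotTail q (c ∷ cs) = q 1 * c + dotTail (λ j → q (suc j)) cs

-- Quotient p / q of power series whose denominator has constant term 1
-- (the only case used: Q_h(0) = 1 and (1 - z)(0) = 1).  c = p/q is the
-- unique series with q·c = p:  c_m = p_m - Σ_{k=1}^m q_k c_{m-k}.
mutual
  -- [c_{m-1}, …, c_1, c_0]
  divPrefix : Series → Series → ℕ → List ℤ
  divPrefix p q zero    = []
  divPrefix p q (suc m) = divS p q m ∷ divPrefix p q m

  divS : Series → Series → Series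
  divS p q m = p m - dotTail q (divPrefix p q m)

Conv : ℤ → ℤ → ℕ → Series
Conv a R h = divS (coeffP (Ppoly a R h)) (coeffP (Qpoly a R h))

substPow : (α : ℕ) → .{{NonZero α}} → Series → Series
substPow α f m = if does (α ∣? m) then f (m / α) else 0ℤ

oneMinusZPow : ℕ → Series
oneMinusZPow k m =
  (if does (m ℕ.≟ 0) then 1ℤ else 0ℤ) - (if does (m ℕ.≟ k) then 1ℤ else 0ℤ)

-- Formal Laurent series (finitely many negative powers in our use),
-- represented by their coefficient function ℤ → ℤ.

Laurent : Set
Laurent = ℤ → ℤ

ofSeries : Series → Laurent
ofSeries f (+ m)     = f m
ofSeries f -[1+ m ]  = 0ℤ

zPowL : ℤ → Laurent → Laurent
zPowL k L j = L (j - k)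

sumL : ℕ → (ℕ → Laurent) → Laurent
sumL n L j = sumTo n (λ d → L d j)

-- The convergent Conv_h(a,R;z) agrees with the series Σ_m R(R+a)⋯(R+(m-1)a) z^m up to z^(2h).
-- Indeed Q_h times that series, minus P_h, satisfies the same three-term recurrence in h as P_h
-- and Q_h, hence equals the explicit series Σ_s a^h s(s-1)⋯(s-h+1) R(R+a)⋯(R+(s-1)a) z^(h+s),
-- whose falling factorial kills every term below z^(2h).  The α-factorial (αq-d)!_(α) is the
-- product (α-d)(2α-d)⋯(αq-d), which is this rising product for (a,R) = (α, α-d), or read
-- backwards for (a,R) = (-α, αq-d).  For the identities at an arbitrary n, exactly one of
-- n, n+1, …, n+α-1 is a multiple of α, namely α⌈n/α⌉, so each sum over d picks out a single
-- coefficient of index ⌈n/α⌉ ≤ n.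
module Submission where

open import Defs
open import Data.Nat using (ℕ; NonZero; _≤_; _<_; _∸_)
open import Data.Nat.DivMod using (_/_)
open import Data.Integer using (ℤ; +_; -_; _-_)
open import Data.Product using (_×_)
open import Relation.Binary.PropositionalEquality using (_≡_)

open import Data.Nat as ℕ using (zero; suc; z≤n; s≤s)
import Data.Nat.Properties as ℕ
open import Data.Nat.DivMod using (_%_; m≡m%n+[m/n]*n; m%n<n; m*n/n≡m)
open import Data.Nat.Divisibility using (_∣_; divides; _∣?_; n∣m*n; ∣m+n∣m⇒∣n; >⇒∤)
open import Data.Integer using (_+_; _*_; _^_; 0ℤ; 1ℤ; -1ℤ)
import Data.Integer as ℤ using (_<_; _<?_)
import Data.Integer.Properties as ℤ
open import Data.Integer.Tactic.RingSolver using (solve-∀)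
open import Data.Empty using (⊥-elim)
open import Data.Product using (Σ; _,_; proj₁; proj₂)
open import Data.Sum using (inj₁; inj₂)
open import Data.List using (List; []; _∷_)
open import Relation.Nullary using (¬_; yes; no)
open import Relation.Nullary.Decidable using (dec-true; dec-false)
open import Relation.Binary.PropositionalEquality
  using (refl; sym; trans; cong; cong₂; subst; module ≡-Reasoning)

sumTo-cong : ∀ n {f g : ℕ → ℤ} → (∀ i → i < n → f i ≡ g i) → sumTo n f ≡ sumTo n g
sumTo-cong zero    f≗g = refl
sumTo-cong (suc n) f≗g =
  cong₂ _+_ (sumTo-cong n (λ i i<n → f≗g i (ℕ.m<n⇒m<1+n i<n))) (f≗g n ℕ.≤-refl)

sumTo-zero : ∀ n {f : ℕ → ℤ} → (∀ i → i < n → f i ≡ 0ℤ) → sumTo n f ≡ 0ℤ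
sumTo-zero zero    f≗0 = refl
sumTo-zero (suc n) f≗0 =
  cong₂ _+_ (sumTo-zero n (λ i i<n → f≗0 i (ℕ.m<n⇒m<1+n i<n))) (f≗0 n ℕ.≤-refl)

sumTo-single : ∀ n {f : ℕ → ℤ} i₀ → i₀ < n → (∀ i → i < n → ¬ i ≡ i₀ → f i ≡ 0ℤ) →
               sumTo n f ≡ f i₀
sumTo-single (suc n) {f} i₀ i₀<1+n others with ℕ.m<1+n⇒m<n∨m≡n i₀<1+n
... | inj₂ refl = begin
  sumTo n f + f n ≡⟨ cong (_+ f n) (sumTo-zero n (λ i i<n →
                       others i (ℕ.m<n⇒m<1+n i<n) (ℕ.<⇒≢ i<n))) ⟩
  0ℤ + f n        ≡⟨ ℤ.+-identityˡ (f n) ⟩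
  f n             ∎
  where open ≡-Reasoning
... | inj₁ i₀<n = begin
  sumTo n f + f n ≡⟨ cong₂ _+_ (sumTo-single n i₀ i₀<n (λ i i<n → others i (ℕ.m<n⇒m<1+n i<n)))
                               (others n ℕ.≤-refl (ℕ.>⇒≢ i₀<n)) ⟩
  f i₀ + 0ℤ       ≡⟨ ℤ.+-identityʳ (f i₀) ⟩
  f i₀            ∎
  where open ≡-Reasoning

sumTo-vanishing-tail : ∀ {m} n {f : ℕ → ℤ} → m ≤ n → (∀ i → m ≤ i → i < n → f i ≡ 0ℤ) →
                       sumTo n f ≡ sumTo m f
sumTo-vanishing-tail n m≤n tail with ℕ.m≤n⇒m<n∨m≡n m≤n
... | inj₂ refl = refl
sumTo-vanishing-tail {m} (suc n) {f} m≤1+n tail | inj₁ (s≤s m≤n) = begin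
  sumTo n f + f n ≡⟨ cong₂ _+_ (sumTo-vanishing-tail n m≤n (λ i m≤i i<n → tail i m≤i (ℕ.m<n⇒m<1+n i<n)))
                               (tail n m≤n ℕ.≤-refl) ⟩
  sumTo m f + 0ℤ  ≡⟨ ℤ.+-identityʳ _ ⟩
  sumTo m f       ∎
  where open ≡-Reasoning

sumTo-sucˡ : ∀ n (f : ℕ → ℤ) → sumTo (suc n) f ≡ f 0 + sumTo n (λ i → f (suc i))
sumTo-sucˡ zero    f = ℤ.+-comm 0ℤ (f 0)
sumTo-sucˡ (suc n) f = begin
  sumTo (suc n) f + f (suc n)                   ≡⟨ cong (_+ f (suc n)) (sumTo-sucˡ n f) ⟩
  f 0 + sumTo n (λ i → f (suc i)) + f (suc n)   ≡⟨ ℤ.+-assoc (f 0) _ _ ⟩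
  f 0 + (sumTo n (λ i → f (suc i)) + f (suc n)) ∎
  where open ≡-Reasoning

sumTo-reverse : ∀ n (f : ℕ → ℤ) → sumTo (suc n) f ≡ sumTo (suc n) (λ i → f (n ∸ i))
sumTo-reverse zero    f = refl
sumTo-reverse (suc n) f = begin
  sumTo (suc n) f + f (suc n)                    ≡⟨ cong (_+ f (suc n)) (sumTo-reverse n f) ⟩
  sumTo (suc n) (λ i → f (n ∸ i)) + f (suc n)    ≡⟨ ℤ.+-comm _ (f (suc n)) ⟩
  f (suc n) + sumTo (suc n) (λ i → f (n ∸ i))    ≡⟨ sumTo-sucˡ (suc n) (λ i → f (suc n ∸ i)) ⟨
  sumTo (suc (suc n)) (λ i → f (suc n ∸ i))      ∎
  where open ≡-Reasoning

sumTo-+ : ∀ n (f g : ℕ → ℤ) → sumTo n (λ i → f i + g i) ≡ sumTo n f + sumTo n g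
sumTo-+ zero    f g = refl
sumTo-+ (suc n) f g = begin
  sumTo n (λ i → f i + g i) + (f n + g n)   ≡⟨ cong (_+ (f n + g n)) (sumTo-+ n f g) ⟩
  sumTo n f + sumTo n g + (f n + g n)       ≡⟨ interchange (sumTo n f) (sumTo n g) (f n) (g n) ⟩
  sumTo n f + f n + (sumTo n g + g n)       ∎
  where
  open ≡-Reasoning
  interchange : ∀ a b c d → a + b + (c + d) ≡ a + c + (b + d)
  interchange = solve-∀

sumTo-*ˡ : ∀ n c (f : ℕ → ℤ) → sumTo n (λ i → c * f i) ≡ c * sumTo n f
sumTo-*ˡ zero    c f = sym (ℤ.*-zeroʳ c)
sumTo-*ˡ (suc n) c f = trans (cong (_+ c * f n) (sumTo-*ˡ n c f))
                             (sym (ℤ.*-distribˡ-+ c (sumTo n f) (f n)))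

shift : Series → Series
shift f zero    = 0ℤ
shift f (suc i) = f i

shift-cong : ∀ {f g : Series} → (∀ i → f i ≡ g i) → ∀ i → shift f i ≡ shift g i
shift-cong f≗g zero    = refl
shift-cong f≗g (suc i) = f≗g i

shift-- : ∀ (f g : Series) i → shift (λ m → f m - g m) i ≡ shift f i - shift g i
shift-- f g zero    = refl
shift-- f g (suc i) = refl

mulS-cong : ∀ {f g : Series} G m → (∀ i → f i ≡ g i) → mulS f G m ≡ mulS g G m
mulS-cong G m f≗g = sumTo-cong (suc m) (λ i _ → cong (_* G (m ∸ i)) (f≗g i))

mulS-sucˡ : ∀ (f G : Series) m → mulS f G (suc m) ≡ f 0 * G (suc m) + mulS (λ i → f (suc i)) G m
mulS-sucˡ f G m = sumTo-sucˡ (suc m) (λ i → f i * G (suc m ∸ i))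

mulS-+ : ∀ (f g G : Series) m → mulS (λ i → f i + g i) G m ≡ mulS f G m + mulS g G m
mulS-+ f g G m = trans (sumTo-cong (suc m) (λ i _ → ℤ.*-distribʳ-+ (G (m ∸ i)) (f i) (g i)))
                       (sumTo-+ (suc m) _ _)

mulS-*ˡ : ∀ c (f G : Series) m → mulS (λ i → c * f i) G m ≡ c * mulS f G m
mulS-*ˡ c f G m = trans (sumTo-cong (suc m) (λ i _ → ℤ.*-assoc c (f i) (G (m ∸ i))))
                        (sumTo-*ˡ (suc m) c _)

mulS-shift : ∀ (f G : Series) m → mulS (shift f) G m ≡ shift (mulS f G) m
mulS-shift f G zero    = ℤ.+-identityˡ _
mulS-shift f G (suc m) = trans (mulS-sucˡ (shift f) G m) (ℤ.+-identityˡ _)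

mulS-constant : ∀ x G m → mulS (coeffP (x ∷ [])) G m ≡ x * G m
mulS-constant x G zero    = ℤ.+-identityˡ _
mulS-constant x G (suc m) = begin
  mulS (coeffP (x ∷ [])) G (suc m)         ≡⟨ mulS-sucˡ (coeffP (x ∷ [])) G m ⟩
  x * G (suc m) + mulS (coeffP []) G m
    ≡⟨ cong (_+_ (x * G (suc m))) (sumTo-zero (suc m) (λ _ _ → refl)) ⟩
  x * G (suc m) + 0ℤ                       ≡⟨ ℤ.+-identityʳ _ ⟩
  x * G (suc m)                            ∎
  where open ≡-Reasoning

reversedPrefix : Series → ℕ → List ℤ
reversedPrefix c zero    = []
reversedPrefix c (suc m) = c m ∷ reversedPrefix c m

dotTail-reversedPrefix : ∀ (q c : Series) m → dotTail q (reversedPrefix c m) + q 0 * c m ≡ mulS q c m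
dotTail-reversedPrefix q c zero    = refl
dotTail-reversedPrefix q c (suc m) = begin
  q 1 * c m + dotTail (λ j → q (suc j)) (reversedPrefix c m) + q 0 * c (suc m)
    ≡⟨ rearrange (q 1 * c m) _ (q 0 * c (suc m)) ⟩
  q 0 * c (suc m) + (dotTail (λ j → q (suc j)) (reversedPrefix c m) + q 1 * c m)
    ≡⟨ cong (_+_ (q 0 * c (suc m))) (dotTail-reversedPrefix (λ j → q (suc j)) c m) ⟩
  q 0 * c (suc m) + mulS (λ j → q (suc j)) c m
    ≡⟨ mulS-sucˡ q c m ⟨
  mulS q c (suc m)
    ∎
  where
  open ≡-Reasoning
  rearrange : ∀ x y z → x + y + z ≡ z + (y + x)
  rearrange = solve-∀

divS-unique : ∀ {p q} c N → q 0 ≡ 1ℤ → (∀ i → i ≤ N → mulS q c i ≡ p i) → ∀ m → m ≤ N → divS p q m ≡ c m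
divS-unique {p} {q} c N q₀≡1 qc≡p = agree
  where
  agree : ∀ m → m ≤ N → divS p q m ≡ c m
  prefixes-agree : ∀ m → m ≤ N → divPrefix p q m ≡ reversedPrefix c m

  agree m m≤N = begin
    p m - dotTail q (divPrefix p q m)
      ≡⟨ cong₂ (λ x L → x - dotTail q L) (sym (qc≡p m m≤N)) (prefixes-agree m m≤N) ⟩
    mulS q c m - dotTail q (reversedPrefix c m)
      ≡⟨ cong (_- dotTail q (reversedPrefix c m)) (dotTail-reversedPrefix q c m) ⟨
    dotTail q (reversedPrefix c m) + q 0 * c m - dotTail q (reversedPrefix c m)
      ≡⟨ cong (λ x → dotTail q (reversedPrefix c m) + x * c m - dotTail q (reversedPrefix c m)) q₀≡1 ⟩
    dotTail q (reversedPrefix c m) + 1ℤ * c m - dotTail q (reversedPrefix c m)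
      ≡⟨ cancel (dotTail q (reversedPrefix c m)) (c m) ⟩
    c m
      ∎
    where
    open ≡-Reasoning
    cancel : ∀ x y → x + 1ℤ * y - x ≡ y
    cancel = solve-∀

  prefixes-agree zero    _     = refl
  prefixes-agree (suc m) 1+m≤N = cong₂ _∷_ (agree m m≤N) (prefixes-agree m m≤N)
    where
    m≤N : m ≤ N
    m≤N = ℕ.≤-trans (ℕ.n≤1+n m) 1+m≤N

dotTail-zero : ∀ (q : Series) L → (∀ j → q (suc j) ≡ 0ℤ) → dotTail q L ≡ 0ℤ
dotTail-zero q []       q⁺≡0 = refl
dotTail-zero q (c ∷ cs) q⁺≡0 =
  cong₂ (λ x y → x * c + y) (q⁺≡0 0) (dotTail-zero (λ j → q (suc j)) cs (λ j → q⁺≡0 (suc j)))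

divS-oneMinusZ : ∀ p m → divS p (oneMinusZPow 1) (suc m) ≡ p (suc m) + divS p (oneMinusZPow 1) m
divS-oneMinusZ p m =
  trans (cong (λ x → p (suc m) - (-1ℤ * divS p q m + x))
              (dotTail-zero (λ j → q (suc j)) (divPrefix p q m) (λ _ → refl)))
        (ring (p (suc m)) (divS p q m))
  where
  q : Series
  q = oneMinusZPow 1
  ring : ∀ P X → P - (-1ℤ * X + 0ℤ) ≡ P + X
  ring = solve-∀

divS-geometric-< : ∀ α i → i < α → divS (oneMinusZPow α) (oneMinusZPow 1) i ≡ 1ℤ
divS-geometric-< (suc _) zero    _     = refl
divS-geometric-< α       (suc i) 1+i<α
  rewrite divS-oneMinusZ (oneMinusZPow α) i
        | dec-false (suc i ℕ.≟ α) (ℕ.<⇒≢ 1+i<α)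
        | divS-geometric-< α i (ℕ.<-trans (ℕ.n<1+n i) 1+i<α) = refl

divS-geometric-≥ : ∀ α i → α ≤ i → divS (oneMinusZPow α) (oneMinusZPow 1) i ≡ 0ℤ
divS-geometric-≥ zero    zero    _     = refl
divS-geometric-≥ α       (suc i) α≤1+i with ℕ.m≤n⇒m<n∨m≡n α≤1+i
... | inj₁ (s≤s α≤i)
  rewrite divS-oneMinusZ (oneMinusZPow α) i
        | dec-false (suc i ℕ.≟ α) (ℕ.>⇒≢ (s≤s α≤i))
        | divS-geometric-≥ α i α≤i = refl
... | inj₂ refl
  rewrite divS-oneMinusZ (oneMinusZPow α) i
        | dec-true (suc i ℕ.≟ suc i) refl
        | divS-geometric-< (suc i) i ℕ.≤-refl = refl

mulS-geometric : ∀ α .{{_ : NonZero α}} (S : Series) u →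
                 mulS (divS (oneMinusZPow α) (oneMinusZPow 1)) S (u ℕ.+ α ∸ 1) ≡ sumTo α (λ d → S (u ℕ.+ d))
mulS-geometric α@(suc a) S u rewrite ℕ.+-suc u a = begin
  sumTo (suc (u ℕ.+ a)) (λ i → g i * S (u ℕ.+ a ∸ i))
    ≡⟨ sumTo-vanishing-tail (suc (u ℕ.+ a)) (s≤s (ℕ.m≤n+m a u))
         (λ i α≤i _ → trans (cong (_* S (u ℕ.+ a ∸ i)) (divS-geometric-≥ α i α≤i))
                             (ℤ.*-zeroˡ (S (u ℕ.+ a ∸ i)))) ⟩
  sumTo α (λ i → g i * S (u ℕ.+ a ∸ i))
    ≡⟨ sumTo-cong α (λ i i<α → trans (cong (_* S (u ℕ.+ a ∸ i)) (divS-geometric-< α i i<α))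
                                     (ℤ.*-identityˡ _)) ⟩
  sumTo α (λ i → S (u ℕ.+ a ∸ i))
    ≡⟨ sumTo-reverse a (λ i → S (u ℕ.+ a ∸ i)) ⟩
  sumTo α (λ d → S (u ℕ.+ a ∸ (a ∸ d)))
    ≡⟨ sumTo-cong α (λ d d<α → cong S (reflect d (ℕ.≤-pred d<α))) ⟩
  sumTo α (λ d → S (u ℕ.+ d))
    ∎
  where
  open ≡-Reasoning
  g : Series
  g = divS (oneMinusZPow α) (oneMinusZPow 1)
  reflect : ∀ d → d ≤ a → u ℕ.+ a ∸ (a ∸ d) ≡ u ℕ.+ d
  reflect d d≤a = trans (ℕ.+-∸-assoc u (ℕ.m∸n≤m a d)) (cong (u ℕ.+_) (ℕ.m∸[m∸n]≡n d≤a))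

substPow-multiple : ∀ α .{{_ : NonZero α}} (F : Series) q → substPow α F (q ℕ.* α) ≡ F q
substPow-multiple α F q rewrite dec-true (α ∣? q ℕ.* α) (n∣m*n q) = cong F (m*n/n≡m q α)

substPow-nonMultiple : ∀ α .{{_ : NonZero α}} (F : Series) {m} → ¬ α ∣ m → substPow α F m ≡ 0ℤ
substPow-nonMultiple α F {m} α∤m rewrite dec-false (α ∣? m) α∤m = refl

∣-window-unique-≤ : ∀ {α u d d′} → d ≤ d′ → d′ < α → α ∣ u ℕ.+ d → α ∣ u ℕ.+ d′ → d ≡ d′
∣-window-unique-≤ {α} {u} {d} {d′} d≤d′ d′<α α∣u+d α∣u+d′ with d′ ∸ d in gap
... | zero  = ℕ.≤-antisym d≤d′ (ℕ.m∸n≡0⇒m≤n gap)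
... | suc e = ⊥-elim (>⇒∤ gap<α (∣m+n∣m⇒∣n (subst (α ∣_) split α∣u+d′) α∣u+d))
  where
  gap<α : suc e < α
  gap<α = subst (_< α) gap (ℕ.≤-<-trans (ℕ.m∸n≤m d′ d) d′<α)
  split : u ℕ.+ d′ ≡ u ℕ.+ d ℕ.+ suc e
  split = trans (cong (u ℕ.+_) (trans (sym (ℕ.m+[n∸m]≡n d≤d′)) (cong (d ℕ.+_) gap)))
                (sym (ℕ.+-assoc u d (suc e)))

∣-window-unique : ∀ {α u d d′} → d < α → d′ < α → α ∣ u ℕ.+ d → α ∣ u ℕ.+ d′ → d ≡ d′
∣-window-unique {d = d} {d′} d<α d′<α α∣u+d α∣u+d′ with ℕ.≤-total d d′
... | inj₁ d≤d′ = ∣-window-unique-≤ d≤d′ d′<α α∣u+d α∣u+d′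
... | inj₂ d′≤d = sym (∣-window-unique-≤ d′≤d d<α α∣u+d′ α∣u+d)

sumTo-substPow-window : ∀ α .{{_ : NonZero α}} (F : ℕ → Series) u q d₀ → d₀ < α → u ℕ.+ d₀ ≡ q ℕ.* α →
                        sumTo α (λ d → substPow α (F d) (u ℕ.+ d)) ≡ F d₀ q
sumTo-substPow-window α F u q d₀ d₀<α u+d₀≡qα =
  trans (sumTo-single α d₀ d₀<α others)
        (trans (cong (substPow α (F d₀)) u+d₀≡qα) (substPow-multiple α (F d₀) q))
  where
  others : ∀ d → d < α → ¬ d ≡ d₀ → substPow α (F d) (u ℕ.+ d) ≡ 0ℤ
  others d d<α d≢d₀ = substPow-nonMultiple α (F d)
    (λ α∣u+d → d≢d₀ (∣-window-unique d<α d₀<α α∣u+d (divides q u+d₀≡qα)))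

ceiling-decomposition : ∀ u α .{{_ : NonZero α}} → Σ ℕ λ d₀ → d₀ < α × u ℕ.+ d₀ ≡ ((u ℕ.+ α ∸ 1) / α) ℕ.* α
ceiling-decomposition u α@(suc a) = a ∸ r , s≤s (ℕ.m∸n≤m a r) , (begin
  u ℕ.+ (a ∸ r)          ≡⟨ ℕ.+-∸-assoc u r≤a ⟨
  u ℕ.+ a ∸ r            ≡⟨ cong (_∸ r) (trans (cong (_∸ 1) (sym (ℕ.+-suc u a))) (m≡m%n+[m/n]*n M α)) ⟩
  r ℕ.+ M / α ℕ.* α ∸ r  ≡⟨ ℕ.m+n∸m≡n r (M / α ℕ.* α) ⟩
  M / α ℕ.* α            ∎)
  where
  open ≡-Reasoning
  M r : ℕ
  M = u ℕ.+ α ∸ 1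
  r = M % α
  r≤a : r ≤ a
  r≤a = ℕ.≤-pred (m%n<n M α)

window-quotient-bounds : ∀ α {n q d₀} → 1 ≤ n → d₀ < α → n ℕ.+ d₀ ≡ q ℕ.* α → 1 ≤ q × q < n ℕ.+ n
window-quotient-bounds α {suc n} {zero}  _ _ ()
window-quotient-bounds α@(suc _) {n} {q@(suc _)} {d₀} 1≤n d₀<α n+d₀≡qα =
  s≤s z≤n , ℕ.≤-<-trans q≤n (ℕ.m<m+n n 1≤n)
  where
  qα<[1+n]α : q ℕ.* α < suc n ℕ.* α
  qα<[1+n]α = begin-strict
    q ℕ.* α       ≡⟨ n+d₀≡qα ⟨
    n ℕ.+ d₀      <⟨ ℕ.+-monoʳ-< n d₀<α ⟩
    n ℕ.+ α       ≤⟨ ℕ.+-monoˡ-≤ α (ℕ.m≤m*n n α) ⟩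
    n ℕ.* α ℕ.+ α ≡⟨ ℕ.+-comm (n ℕ.* α) α ⟩
    suc n ℕ.* α   ∎
    where open ℕ.≤-Reasoning
  q≤n : q ≤ n
  q≤n = ℕ.≤-pred (ℕ.*-cancelʳ-< α q (suc n) qα<[1+n]α)

sumL-shifted : ∀ N (S : ℕ → Series) n →
               sumL N (λ d → zPowL (- + d) (ofSeries (S d))) (+ n) ≡ sumTo N (λ d → S d (n ℕ.+ d))
sumL-shifted N S n =
  sumTo-cong N (λ d _ → cong (ofSeries (S d)) (cong (_+_ (+ n)) (ℤ.neg-involutive (+ d))))

coeffP-addP : ∀ p q i → coeffP (addP p q) i ≡ coeffP p i + coeffP q i
coeffP-addP []      q       i       = sym (ℤ.+-identityˡ _)
coeffP-addP (x ∷ p) []      i       = sym (ℤ.+-identityʳ _)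
coeffP-addP (x ∷ p) (y ∷ q) zero    = refl
coeffP-addP (x ∷ p) (y ∷ q) (suc i) = coeffP-addP p q i

coeffP-scaleP : ∀ c p i → coeffP (scaleP c p) i ≡ c * coeffP p i
coeffP-scaleP c []      i       = sym (ℤ.*-zeroʳ c)
coeffP-scaleP c (x ∷ p) zero    = refl
coeffP-scaleP c (x ∷ p) (suc i) = coeffP-scaleP c p i

coeffP-zP : ∀ p i → coeffP (zP p) i ≡ shift (coeffP p) i
coeffP-zP p zero    = refl
coeffP-zP p (suc i) = refl

recLinear : ℤ → ℤ → ℕ → ℤ
recLinear a R k = - (R + + 2 * a * + suc k)

recQuadratic : ℤ → ℤ → ℕ → ℤ
recQuadratic a R k = - (a * (R + a * + k) * + suc k)

stepS : ℤ → ℤ → ℕ → Series → Series → Series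
stepS a R k F₁ F₂ m = F₁ m + (recLinear a R k * shift F₁ m + recQuadratic a R k * shift (shift F₂) m)

stepS-cong : ∀ a R k {F₁ F₂ G₁ G₂ : Series} → (∀ i → F₁ i ≡ G₁ i) → (∀ i → F₂ i ≡ G₂ i) →
             ∀ m → stepS a R k F₁ F₂ m ≡ stepS a R k G₁ G₂ m
stepS-cong a R k F₁≗G₁ F₂≗G₂ m =
  cong₂ _+_ (F₁≗G₁ m)
    (cong₂ (λ x y → recLinear a R k * x + recQuadratic a R k * y)
           (shift-cong F₁≗G₁ m) (shift-cong (shift-cong F₂≗G₂) m))

coeffP-recStep : ∀ a R k F₁ F₂ m →
                 coeffP (recStep a R k F₁ F₂) m ≡ stepS a R k (coeffP F₁) (coeffP F₂) m
coeffP-recStep a R k F₁ F₂ m = begin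
  coeffP (recStep a R k F₁ F₂) m
    ≡⟨ coeffP-addP F₁ _ m ⟩
  coeffP F₁ m + coeffP (addP (scaleP b (zP F₁)) (scaleP l (zP (zP F₂)))) m
    ≡⟨ cong (_+_ (coeffP F₁ m)) (coeffP-addP (scaleP b (zP F₁)) (scaleP l (zP (zP F₂))) m) ⟩
  coeffP F₁ m + (coeffP (scaleP b (zP F₁)) m + coeffP (scaleP l (zP (zP F₂))) m)
    ≡⟨ cong (_+_ (coeffP F₁ m)) (cong₂ _+_ (coeffP-scaleP b (zP F₁) m) (coeffP-scaleP l (zP (zP F₂)) m)) ⟩
  coeffP F₁ m + (b * coeffP (zP F₁) m + l * coeffP (zP (zP F₂)) m)
    ≡⟨ cong (_+_ (coeffP F₁ m)) (cong₂ (λ x y → b * x + l * y) (coeffP-zP F₁ m)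
                                        (trans (coeffP-zP (zP F₂) m) (shift-cong (coeffP-zP F₂) m))) ⟩
  stepS a R k (coeffP F₁) (coeffP F₂) m
    ∎
  where
  open ≡-Reasoning
  b l : ℤ
  b = recLinear a R k
  l = recQuadratic a R k

mulS-stepS : ∀ a R k F₁ F₂ G m → mulS (stepS a R k F₁ F₂) G m ≡ stepS a R k (mulS F₁ G) (mulS F₂ G) m
mulS-stepS a R k F₁ F₂ G m = begin
  mulS (stepS a R k F₁ F₂) G m
    ≡⟨ mulS-+ F₁ _ G m ⟩
  mulS F₁ G m + mulS (λ i → b * shift F₁ i + l * shift (shift F₂) i) G m
    ≡⟨ cong (_+_ (mulS F₁ G m)) (mulS-+ (λ i → b * shift F₁ i) _ G m) ⟩
  mulS F₁ G m + (mulS (λ i → b * shift F₁ i) G m + mulS (λ i → l * shift (shift F₂) i) G m)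
    ≡⟨ cong (_+_ (mulS F₁ G m)) (cong₂ _+_ (mulS-*ˡ b (shift F₁) G m) (mulS-*ˡ l (shift (shift F₂)) G m)) ⟩
  mulS F₁ G m + (b * mulS (shift F₁) G m + l * mulS (shift (shift F₂)) G m)
    ≡⟨ cong (_+_ (mulS F₁ G m)) (cong₂ (λ x y → b * x + l * y) (mulS-shift F₁ G m)
            (trans (mulS-shift (shift F₂) G m) (shift-cong (mulS-shift F₂ G) m))) ⟩
  stepS a R k (mulS F₁ G) (mulS F₂ G) m
    ∎
  where
  open ≡-Reasoning
  b l : ℤ
  b = recLinear a R k
  l = recQuadratic a R k

IsRecSolution : ℤ → ℤ → (ℕ → Series) → Set
IsRecSolution a R F = ∀ k m → F (suc (suc k)) m ≡ stepS a R k (F (suc k)) (F k) m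

recSeq-isRecSolution : ∀ a R F₀ F₁ → IsRecSolution a R (λ h → coeffP (recSeq a R F₀ F₁ h))
recSeq-isRecSolution a R F₀ F₁ k =
  coeffP-recStep a R k (recSeq a R F₀ F₁ (suc k)) (recSeq a R F₀ F₁ k)

mulS-isRecSolution : ∀ a R {F} G → IsRecSolution a R F → IsRecSolution a R (λ h → mulS (F h) G)
mulS-isRecSolution a R {F} G sol k m =
  trans (mulS-cong G m (sol k)) (mulS-stepS a R k (F (suc k)) (F k) G m)

difference-isRecSolution : ∀ a R {F F′} → IsRecSolution a R F → IsRecSolution a R F′ →
                           IsRecSolution a R (λ h m → F h m - F′ h m)
difference-isRecSolution a R {F} {F′} sol sol′ k m = begin
  F (suc (suc k)) m - F′ (suc (suc k)) m
    ≡⟨ cong₂ _-_ (sol k m) (sol′ k m) ⟩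
  stepS a R k (F (suc k)) (F k) m - stepS a R k (F′ (suc k)) (F′ k) m
    ≡⟨ linear (F (suc k) m) (F′ (suc k) m) b l _ _ _ _ ⟩
  (F (suc k) m - F′ (suc k) m)
    + (b * (shift (F (suc k)) m - shift (F′ (suc k)) m)
       + l * (shift (shift (F k)) m - shift (shift (F′ k)) m))
    ≡⟨ cong (_+_ (F (suc k) m - F′ (suc k) m))
            (cong₂ (λ x y → b * x + l * y) (sym (shift-- (F (suc k)) (F′ (suc k)) m))
                   (sym (trans (shift-cong (shift-- (F k) (F′ k)) m) (shift-- _ _ m)))) ⟩
  stepS a R k (λ i → F (suc k) i - F′ (suc k) i) (λ i → F k i - F′ k i) m
    ∎
  where
  open ≡-Reasoning
  b l : ℤ
  b = recLinear a R k
  l = recQuadratic a R k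
  linear : ∀ X x b l Y y Z z →
           X + (b * Y + l * Z) - (x + (b * y + l * z)) ≡ (X - x) + (b * (Y - y) + l * (Z - z))
  linear = solve-∀

isRecSolution-unique : ∀ a R {F F′} → IsRecSolution a R F → IsRecSolution a R F′ →
                       (∀ m → F 0 m ≡ F′ 0 m) → (∀ m → F 1 m ≡ F′ 1 m) → ∀ h m → F h m ≡ F′ h m
isRecSolution-unique a R {F} {F′} sol sol′ eq₀ eq₁ h = proj₁ (consecutive h)
  where
  consecutive : ∀ h → (∀ m → F h m ≡ F′ h m) × (∀ m → F (suc h) m ≡ F′ (suc h) m)
  consecutive zero    = eq₀ , eq₁
  consecutive (suc k) with consecutive k
  ... | eqₖ , eqₖ₊₁ = eqₖ₊₁ , λ m →
    trans (sol k m) (trans (stepS-cong a R k eqₖ₊₁ eqₖ m) (sym (sol′ k m)))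

rising : ℤ → ℤ → ℕ → ℤ
rising a R zero    = 1ℤ
rising a R (suc m) = rising a R m * (R + a * + m)

rising-sucˡ : ∀ a R m → rising a R (suc m) ≡ R * rising a (R + a) m
rising-sucˡ a R zero    = ring a R
  where
  ring : ∀ a R → 1ℤ * (R + a * 0ℤ) ≡ R * 1ℤ
  ring = solve-∀
rising-sucˡ a R (suc m) = begin
  rising a R (suc m) * (R + a * + suc m)       ≡⟨ cong (_* (R + a * + suc m)) (rising-sucˡ a R m) ⟩
  R * rising a (R + a) m * (R + a * + suc m)   ≡⟨ ring a R (rising a (R + a) m) (+ m) ⟩
  R * rising a (R + a) (suc m)                 ∎
  where
  open ≡-Reasoning
  ring : ∀ a R X M → R * X * (R + a * (1ℤ + M)) ≡ R * (X * ((R + a) + a * M))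
  ring = solve-∀

rising-reverse : ∀ a R q → rising (- a) (R + a * + q) (suc q) ≡ rising a R (suc q)
rising-reverse a R zero    = ring a R
  where
  ring : ∀ a R → 1ℤ * (R + a * 0ℤ + - a * 0ℤ) ≡ 1ℤ * (R + a * 0ℤ)
  ring = solve-∀
rising-reverse a R (suc q) = begin
  rising (- a) (R + a * + suc q) (suc (suc q))
    ≡⟨ rising-sucˡ (- a) (R + a * + suc q) (suc q) ⟩
  (R + a * + suc q) * rising (- a) (R + a * + suc q + - a) (suc q)
    ≡⟨ cong (λ X → (R + a * + suc q) * rising (- a) X (suc q)) (ring a R (+ q)) ⟩
  (R + a * + suc q) * rising (- a) (R + a * + q) (suc q)
    ≡⟨ cong (_*_ (R + a * + suc q)) (rising-reverse a R q) ⟩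
  (R + a * + suc q) * rising a R (suc q)
    ≡⟨ ℤ.*-comm (R + a * + suc q) _ ⟩
  rising a R (suc (suc q))
    ∎
  where
  open ≡-Reasoning
  ring : ∀ a R Q → R + a * (1ℤ + Q) + - a ≡ R + a * Q
  ring = solve-∀

rising-vanish : ∀ a R {i m} → i < m → R + a * + i ≡ 0ℤ → rising a R m ≡ 0ℤ
rising-vanish a R {i} {suc m} i<1+m factor≡0 with ℕ.m<1+n⇒m<n∨m≡n i<1+m
... | inj₁ i<m  = trans (cong (_* (R + a * + m)) (rising-vanish a R i<m factor≡0))
                        (ℤ.*-zeroˡ (R + a * + m))
... | inj₂ refl = trans (cong (_*_ (rising a R m)) factor≡0) (ℤ.*-zeroʳ (rising a R m))

-- The coefficient of z^m in Σ_s a^h (s)_h ρ(s) z^(h+s), where ρ = rising a R and (s)_h = rising -1ℤ s h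
-- is the falling factorial; for m < h the truncated m ∸ h = 0 is harmless, as (0)_h = 0 when h ≥ 1.
remainder : ℤ → ℤ → ℕ → Series
remainder a R h m = a ^ h * rising -1ℤ (+ (m ∸ h)) h * rising a R (m ∸ h)

remainder-vanish : ∀ a R h m → m < h ℕ.+ h → remainder a R h m ≡ 0ℤ
remainder-vanish a R h@(suc _) m m<2h = begin
  a ^ h * rising -1ℤ (+ s) h * rising a R s   ≡⟨ cong (λ x → a ^ h * x * rising a R s) falling≡0 ⟩
  a ^ h * 0ℤ * rising a R s                   ≡⟨ cong (_* rising a R s) (ℤ.*-zeroʳ (a ^ h)) ⟩
  0ℤ * rising a R s                           ≡⟨ ℤ.*-zeroˡ (rising a R s) ⟩
  0ℤ                                          ∎
  where
  open ≡-Reasoning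
  s : ℕ
  s = m ∸ h
  cancel : ∀ S → S + -1ℤ * S ≡ 0ℤ
  cancel = solve-∀
  falling≡0 : rising -1ℤ (+ s) h ≡ 0ℤ
  falling≡0 = rising-vanish -1ℤ (+ s) (ℕ.m<n+o⇒m∸n<o m h m<2h) (cancel (+ s))

module _ (a R : ℤ) where

  private
    vanishes : ∀ h i → i ≤ suc h → remainder a R (suc h) i ≡ 0ℤ
    vanishes h i i≤1+h = remainder-vanish a R (suc h) i (ℕ.≤-<-trans i≤1+h (ℕ.m<m+n (suc h) (s≤s z≤n)))

    allZero : ∀ k {X Y U V} → X ≡ 0ℤ → Y ≡ 0ℤ → U ≡ 0ℤ → V ≡ 0ℤ →
              X ≡ Y + (recLinear a R k * U + recQuadratic a R k * V)
    allZero k refl refl refl refl = zeros (recLinear a R k) (recQuadratic a R k)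
      where
      zeros : ∀ b l → 0ℤ ≡ 0ℤ + (b * 0ℤ + l * 0ℤ)
      zeros = solve-∀

    1+k+s∸k≡1+s : ∀ k s → suc (k ℕ.+ s) ∸ k ≡ suc s
    1+k+s∸k≡1+s k s = trans (cong (_∸ k) (sym (ℕ.+-suc k s))) (ℕ.m+n∸m≡n k (suc s))

  -- Writing F for the falling factorial s(s-1)⋯(s-k+1), both sides are a^k F ρ(s) times a
  -- polynomial in a, R, s, k, so once the factorials are unfolded this is a ring identity.
  remainder-step : ∀ k s → remainder a R (suc (suc k)) (suc (suc (k ℕ.+ s)))
                           ≡ stepS a R k (remainder a R (suc k)) (remainder a R k) (suc (suc (k ℕ.+ s)))
  remainder-step k s rewrite 1+k+s∸k≡1+s k s | ℕ.m+n∸m≡n k s | rising-sucˡ -1ℤ (+ suc s) k =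
    key a R (+ s) (+ k) (a ^ k) (rising -1ℤ (+ s) k) (rising a R s)
    where
    key : ∀ a R S K A F ρ →
      a * (a * A) * (F * (S + -1ℤ * K) * (S + -1ℤ * (1ℤ + K))) * ρ
      ≡ a * A * ((1ℤ + S) * F) * (ρ * (R + a * S))
        + ((- (R + + 2 * a * (1ℤ + K))) * (a * A * (F * (S + -1ℤ * K)) * ρ)
           + (- (a * (R + a * K) * (1ℤ + K))) * (A * F * ρ))
    key = solve-∀

  remainder-isRecSolution : IsRecSolution a R (remainder a R)
  remainder-isRecSolution k zero =
    allZero k (vanishes (suc k) 0 z≤n) (vanishes k 0 z≤n) refl refl
  remainder-isRecSolution k (suc zero) =
    allZero k (vanishes (suc k) 1 (s≤s z≤n)) (vanishes k 1 (s≤s z≤n)) (vanishes k 0 z≤n) refl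
  remainder-isRecSolution k (suc (suc i)) with i ℕ.<? k
  remainder-isRecSolution (suc k) (suc (suc i)) | yes (s≤s i≤k) =
    allZero (suc k) (vanishes (suc (suc k)) (suc (suc i)) (s≤s (s≤s (ℕ.m≤n⇒m≤1+n i≤k))))
                    (vanishes (suc k) (suc (suc i)) (s≤s (s≤s i≤k)))
                    (vanishes (suc k) (suc i) (s≤s (ℕ.m≤n⇒m≤1+n i≤k)))
                    (vanishes k i (ℕ.m≤n⇒m≤1+n i≤k))
  ... | no i≮k = subst (λ j → remainder a R (suc (suc k)) (suc (suc j))
                               ≡ stepS a R k (remainder a R (suc k)) (remainder a R k) (suc (suc j)))
                       (ℕ.m+[n∸m]≡n (ℕ.≮⇒≥ i≮k)) (remainder-step k (i ∸ k))

approxError : ℤ → ℤ → ℕ → Series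
approxError a R h m = mulS (coeffP (Qpoly a R h)) (rising a R) m - coeffP (Ppoly a R h) m

approxError≡remainder : ∀ a R h m → approxError a R h m ≡ remainder a R h m
approxError≡remainder a R =
  isRecSolution-unique a R {F = approxError a R}
    (difference-isRecSolution a R {λ h → mulS (Q h) (rising a R)} {λ h → coeffP (Ppoly a R h)}
      (mulS-isRecSolution a R {F = Q} (rising a R) (recSeq-isRecSolution a R (1ℤ ∷ []) (1ℤ ∷ - R ∷ [])))
      (recSeq-isRecSolution a R [] (1ℤ ∷ [])))
    (remainder-isRecSolution a R) base₀ base₁
  where
  Q : ℕ → Series
  Q h = coeffP (Qpoly a R h)
  base₀ : ∀ m → approxError a R 0 m ≡ remainder a R 0 m
  base₀ m = trans (cong (_- 0ℤ) (mulS-constant 1ℤ (rising a R) m)) (ring (rising a R m))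
    where
    ring : ∀ ρ → 1ℤ * ρ - 0ℤ ≡ 1ℤ * 1ℤ * ρ
    ring = solve-∀
  base₁ : ∀ m → approxError a R 1 m ≡ remainder a R 1 m
  base₁ zero    = sym (remainder-vanish a R 1 0 (s≤s z≤n))
  base₁ (suc m) = begin
    mulS (coeffP (1ℤ ∷ - R ∷ [])) (rising a R) (suc m) - 0ℤ
      ≡⟨ cong (_- 0ℤ) (mulS-sucˡ (coeffP (1ℤ ∷ - R ∷ [])) (rising a R) m) ⟩
    1ℤ * rising a R (suc m) + mulS (coeffP (- R ∷ [])) (rising a R) m - 0ℤ
      ≡⟨ cong (λ x → 1ℤ * rising a R (suc m) + x - 0ℤ) (mulS-constant (- R) (rising a R) m) ⟩
    1ℤ * (rising a R m * (R + a * + m)) + - R * rising a R m - 0ℤ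
      ≡⟨ ring a R (+ m) (rising a R m) ⟩
    remainder a R 1 (suc m)
      ∎
    where
    open ≡-Reasoning
    ring : ∀ a R M ρ → 1ℤ * (ρ * (R + a * M)) + - R * ρ - 0ℤ ≡ a * 1ℤ * (1ℤ * (M + -1ℤ * 0ℤ)) * ρ
    ring = solve-∀

Qpoly-constantTerm : ∀ a R h → coeffP (Qpoly a R h) 0 ≡ 1ℤ
Qpoly-constantTerm a R zero          = refl
Qpoly-constantTerm a R (suc zero)    = refl
Qpoly-constantTerm a R (suc (suc k)) =
  trans (coeffP-recStep a R k (Qpoly a R (suc k)) (Qpoly a R k) 0)
        (trans (cong (λ x → x + (recLinear a R k * 0ℤ + recQuadratic a R k * 0ℤ))
                     (Qpoly-constantTerm a R (suc k)))
               (ring (recLinear a R k) (recQuadratic a R k)))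
  where
  ring : ∀ b l → 1ℤ + (b * 0ℤ + l * 0ℤ) ≡ 1ℤ
  ring = solve-∀

Conv-rising : ∀ a R h m → m < h ℕ.+ h → Conv a R h m ≡ rising a R m
Conv-rising a R h m m<2h =
  divS-unique (rising a R) m (Qpoly-constantTerm a R h) QG≡P m ℕ.≤-refl
  where
  QG≡P : ∀ i → i ≤ m → mulS (coeffP (Qpoly a R h)) (rising a R) i ≡ coeffP (Ppoly a R h) i
  QG≡P i i≤m = ℤ.i-j≡0⇒i≡j _ _
    (trans (approxError≡remainder a R h i) (remainder-vanish a R h i (ℕ.≤-<-trans i≤m m<2h)))

afactFuel-pos : ∀ α f x → 0ℤ ℤ.< x → afactFuel α (suc f) x ≡ x * afactFuel α f (x - + α)
afactFuel-pos α f x 0<x rewrite dec-true (0ℤ ℤ.<? x) 0<x = refl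

afactFuel-nonPos : ∀ α f s → s < α → afactFuel α f (- + s) ≡ 1ℤ
afactFuel-nonPos α zero    s s<α = refl
afactFuel-nonPos α (suc f) s s<α
  rewrite dec-false (0ℤ ℤ.<? - + s) (ℤ.≤⇒≯ ℤ.neg-≤-pos)
        | dec-true (- + α ℤ.<? - + s) (ℤ.neg-mono-< (ℤ.+<+ s<α)) = refl

-- Every step of the recursion peels off one factor r + jα of the product, so enough fuel
-- leaves it with the argument r - α ∈ (-α, 0].
afactFuel-rising : ∀ α f r j → 1 ≤ r → r ≤ α → j < f →
                   afactFuel α f (+ (j ℕ.* α ℕ.+ r)) ≡ rising (+ α) (+ r) (suc j)
afactFuel-rising α (suc f) r zero 1≤r r≤α _ = begin
  afactFuel α (suc f) (+ r)        ≡⟨ afactFuel-pos α f (+ r) (ℤ.+<+ 1≤r) ⟩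
  + r * afactFuel α f (+ r - + α)  ≡⟨ cong (λ x → + r * afactFuel α f x) r-α≡-[α∸r] ⟩
  + r * afactFuel α f (- + (α ∸ r)) ≡⟨ cong (_*_ (+ r)) (afactFuel-nonPos α f (α ∸ r) α∸r<α) ⟩
  + r * 1ℤ                         ≡⟨ ring (+ α) (+ r) ⟩
  rising (+ α) (+ r) 1             ∎
  where
  open ≡-Reasoning
  r-α≡-[α∸r] : + r - + α ≡ - + (α ∸ r)
  r-α≡-[α∸r] = trans (ℤ.m-n≡m⊖n r α) (ℤ.⊖-≤ r≤α)
  α∸r<α : α ∸ r < α
  α∸r<α = ℕ.∸-monoʳ-< {α} {r} {0} 1≤r r≤α
  ring : ∀ a r → r * 1ℤ ≡ 1ℤ * (r + a * 0ℤ)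
  ring = solve-∀
afactFuel-rising α (suc f) r (suc j) 1≤r r≤α (s≤s j<f) = begin
  afactFuel α (suc f) x                             ≡⟨ afactFuel-pos α f x 0<x ⟩
  x * afactFuel α f (x - + α)                       ≡⟨ cong (λ y → x * afactFuel α f y) x-α≡ ⟩
  x * afactFuel α f (+ (j ℕ.* α ℕ.+ r))             ≡⟨ cong (_*_ x) (afactFuel-rising α f r j 1≤r r≤α j<f) ⟩
  x * rising (+ α) (+ r) (suc j)                    ≡⟨ cong (_* rising (+ α) (+ r) (suc j)) x≡ ⟩
  (+ r + + α * + suc j) * rising (+ α) (+ r) (suc j) ≡⟨ ℤ.*-comm (+ r + + α * + suc j) _ ⟩
  rising (+ α) (+ r) (suc (suc j))                  ∎
  where
  open ≡-Reasoning
  x : ℤ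
  x = + (suc j ℕ.* α ℕ.+ r)
  0<x : 0ℤ ℤ.< x
  0<x = ℤ.+<+ (ℕ.≤-trans 1≤r (ℕ.m≤n+m r (suc j ℕ.* α)))
  x≡ : x ≡ + r + + α * + suc j
  x≡ = trans (cong (_+ + r) (ℤ.pos-* (suc j) α)) (commute (+ suc j) (+ α) (+ r))
    where
    commute : ∀ J A R → J * A + R ≡ R + A * J
    commute = solve-∀
  x-α≡ : x - + α ≡ + (j ℕ.* α ℕ.+ r)
  x-α≡ = cancel (+ α) (+ (j ℕ.* α)) (+ r)
    where
    cancel : ∀ A B R → A + B + R - A ≡ B + R
    cancel = solve-∀

afact-rising : ∀ α d q → d < α → 1 ≤ q → afact α (+ (α ℕ.* q) - + d) ≡ rising (+ α) (+ α - + d) q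
afact-rising α@(suc _) d (suc j) d<α _ = begin
  afact α (+ (α ℕ.* suc j) - + d)     ≡⟨ cong (afact α) argument≡ ⟩
  afact α (+ (j ℕ.* α ℕ.+ (α ∸ d)))
    ≡⟨ afactFuel-rising α _ (α ∸ d) j (ℕ.m<n⇒0<n∸m d<α) (ℕ.m∸n≤m α d) j<fuel ⟩
  rising (+ α) (+ (α ∸ d)) (suc j)    ≡⟨ cong (λ R → rising (+ α) R (suc j)) α∸d≡α-d ⟩
  rising (+ α) (+ α - + d) (suc j)    ∎
  where
  open ≡-Reasoning
  α∸d≡α-d : + (α ∸ d) ≡ + α - + d
  α∸d≡α-d = sym (trans (ℤ.m-n≡m⊖n α d) (ℤ.⊖-≥ (ℕ.<⇒≤ d<α)))
  argument≡ : + (α ℕ.* suc j) - + d ≡ + (j ℕ.* α ℕ.+ (α ∸ d))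
  argument≡ = begin
    + (α ℕ.* suc j) - + d           ≡⟨ cong (_- + d) (ℤ.pos-* α (suc j)) ⟩
    + α * (1ℤ + + j) - + d          ≡⟨ ring (+ α) (+ j) (+ d) ⟩
    + j * + α + (+ α - + d)         ≡⟨ cong₂ _+_ (ℤ.pos-* j α) α∸d≡α-d ⟨
    + (j ℕ.* α ℕ.+ (α ∸ d))         ∎
    where
    ring : ∀ A J D → A * (1ℤ + J) - D ≡ J * A + (A - D)
    ring = solve-∀
  j<fuel : j < suc (j ℕ.* α ℕ.+ (α ∸ d))
  j<fuel = s≤s (ℕ.≤-trans (ℕ.m≤m*n j α) (ℕ.m≤m+n (j ℕ.* α) (α ∸ d)))

rising-reverse-multiple : ∀ α d q → 1 ≤ q →
                          rising (- + α) (+ (α ℕ.* q) - + d) q ≡ rising (+ α) (+ α - + d) q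
rising-reverse-multiple α d (suc j) _ = begin
  rising (- + α) (+ (α ℕ.* suc j) - + d) (suc j)      ≡⟨ cong (λ R → rising (- + α) R (suc j)) start≡ ⟩
  rising (- + α) (+ α - + d + + α * + j) (suc j)      ≡⟨ rising-reverse (+ α) (+ α - + d) j ⟩
  rising (+ α) (+ α - + d) (suc j)                    ∎
  where
  open ≡-Reasoning
  ring : ∀ A J D → A * (1ℤ + J) - D ≡ A - D + A * J
  ring = solve-∀
  start≡ : + (α ℕ.* suc j) - + d ≡ + α - + d + + α * + j
  start≡ = trans (cong (_- + d) (ℤ.pos-* α (suc j))) (ring (+ α) (+ j) (+ d))

afact≡Conv : ∀ α d q h → d < α → 1 ≤ q → q < h ℕ.+ h →
             afact α (+ (α ℕ.* q) - + d) ≡ Conv (+ α) (+ α - + d) h q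
afact≡Conv α d q h d<α 1≤q q<2h =
  trans (afact-rising α d q d<α 1≤q) (sym (Conv-rising (+ α) (+ α - + d) h q q<2h))

afact≡Conv-reversed : ∀ α d q h → d < α → 1 ≤ q → q < h ℕ.+ h →
                      afact α (+ (α ℕ.* q) - + d) ≡ Conv (- + α) (+ (α ℕ.* q) - + d) h q
afact≡Conv-reversed α d q h d<α 1≤q q<2h =
  trans (afact-rising α d q d<α 1≤q)
        (sym (trans (Conv-rising (- + α) _ h q q<2h) (rising-reverse-multiple α d q 1≤q)))

+n≡+[α*q]-+d : ∀ α n q d → n ℕ.+ d ≡ q ℕ.* α → + n ≡ + (α ℕ.* q) - + d
+n≡+[α*q]-+d α n q d n+d≡qα =
  sym (trans (cong (λ m → + m - + d) (trans (ℕ.*-comm α q) (sym n+d≡qα))) (cancel (+ n) (+ d)))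
  where
  cancel : ∀ N D → N + D - D ≡ N
  cancel = solve-∀

module _ (α : ℕ) .{{_ : NonZero α}} (n : ℕ) (1≤n : 1 ≤ n) {d₀ : ℕ} (d₀<α : d₀ < α)
         (n+d₀≡qα : n ℕ.+ d₀ ≡ ((n ℕ.+ α ∸ 1) / α) ℕ.* α) where

  private
    q : ℕ
    q = (n ℕ.+ α ∸ 1) / α

    bounds : 1 ≤ q × q < n ℕ.+ n
    bounds = window-quotient-bounds α 1≤n d₀<α n+d₀≡qα

    n≡αq-d₀ : + n ≡ + (α ℕ.* q) - + d₀
    n≡αq-d₀ = +n≡+[α*q]-+d α n q d₀ n+d₀≡qα

    window : ∀ F → sumTo α (λ d → substPow α (F d) (n ℕ.+ d)) ≡ F d₀ q
    window F = sumTo-substPow-window α F n q d₀ d₀<α n+d₀≡qα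

  afact≡Conv-ceiling : afact α (+ n) ≡ Conv (- + α) (+ n) n q
  afact≡Conv-ceiling = subst (λ x → afact α x ≡ Conv (- + α) x n q) (sym n≡αq-d₀)
                             (afact≡Conv-reversed α d₀ q n d₀<α (proj₁ bounds) (proj₂ bounds))

  afact≡sumL-shifted : afact α (+ n) ≡
                       sumL α (λ d → zPowL (- + d) (ofSeries (substPow α (Conv (+ α) (+ α - + d) n)))) (+ n)
  afact≡sumL-shifted = begin
    afact α (+ n)
      ≡⟨ cong (afact α) n≡αq-d₀ ⟩
    afact α (+ (α ℕ.* q) - + d₀)
      ≡⟨ afact≡Conv α d₀ q n d₀<α (proj₁ bounds) (proj₂ bounds) ⟩
    Conv (+ α) (+ α - + d₀) n q
      ≡⟨ window (λ d → Conv (+ α) (+ α - + d) n) ⟨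
    sumTo α (λ d → substPow α (Conv (+ α) (+ α - + d) n) (n ℕ.+ d))
      ≡⟨ sumL-shifted α (λ d → substPow α (Conv (+ α) (+ α - + d) n)) n ⟨
    sumL α (λ d → zPowL (- + d) (ofSeries (substPow α (Conv (+ α) (+ α - + d) n)))) (+ n)
      ∎
    where open ≡-Reasoning

  afact≡mulS-geometric : afact α (+ n) ≡ mulS (divS (oneMinusZPow α) (oneMinusZPow 1))
                                              (substPow α (Conv (- + α) (+ n) n)) (n ℕ.+ α ∸ 1)
  afact≡mulS-geometric = begin
    afact α (+ n)
      ≡⟨ afact≡Conv-ceiling ⟩
    Conv (- + α) (+ n) n q
      ≡⟨ window (λ _ → Conv (- + α) (+ n) n) ⟨
    sumTo α (λ d → substPow α (Conv (- + α) (+ n) n) (n ℕ.+ d))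
      ≡⟨ mulS-geometric α (substPow α (Conv (- + α) (+ n) n)) n ⟨
    mulS (divS (oneMinusZPow α) (oneMinusZPow 1)) (substPow α (Conv (- + α) (+ n) n)) (n ℕ.+ α ∸ 1)
      ∎
    where open ≡-Reasoning

mainTheorem9 : (α : ℕ) → .{{_ : NonZero α}} →
    ((n d : ℕ) → 1 ≤ n → d < α →
      (afact α (+ (α Data.Nat.* n) - + d) ≡ Conv (- + α) (+ (α Data.Nat.* n) - + d) n n)
      × (afact α (+ (α Data.Nat.* n) - + d) ≡ Conv (+ α) (+ α - + d) n n))
    × ((n : ℕ) → 1 ≤ n →
      (afact α (+ n) ≡ Conv (- + α) (+ n) n ((n Data.Nat.+ α ∸ 1) / α))
      × (afact α (+ n)
          ≡ sumL α (λ d → zPowL (- + d) (ofSeries (substPow α (Conv (+ α) (+ α - + d) n)))) (+ n))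
      × (afact α (+ n)
          ≡ mulS (divS (oneMinusZPow α) (oneMinusZPow 1))
                 (substPow α (Conv (- + α) (+ n) n)) (n Data.Nat.+ α ∸ 1)))
mainTheorem9 α =
  (λ n d 1≤n d<α → afact≡Conv-reversed α d n n d<α 1≤n (ℕ.m<m+n n 1≤n)
                 , afact≡Conv α d n n d<α 1≤n (ℕ.m<m+n n 1≤n)) ,
  (λ n 1≤n → let d₀ , d₀<α , n+d₀≡qα = ceiling-decomposition n α in
     afact≡Conv-ceiling α n 1≤n d₀<α n+d₀≡qα
   , afact≡sumL-shifted α n 1≤n d₀<α n+d₀≡qα
   , afact≡mulS-geometric α n 1≤n d₀<α n+d₀≡qα)
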